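{- Let $h,m$ be positive integers with $h=1$ or $\omega(m)=1$, and let $c$ be an upper bound on the arities $n$ for which $\mathrm{AND}_n$ is computable by a $\mathrm{CC}_h[m]$-circuit. Let $L\subseteq\{0,1\}^*$ be a language recognizable by $\mathrm{CC}_h[m]$-circuits (for each length $n$ some $\mathrm{CC}_h[m]$-circuit with $n$ inputs accepts exactly the words of $L$ of length $n$). Then for each $n$, the number of words in $L$ of length $n$ is either $0$ or at least $2^{n-c}$.
   Context: For $A\subseteq\{0,\dots,m-1\}$, the gate $\mathrm{MOD}_m^A$ (unbounded fan-in) outputs $1$ iff the sum of its boolean inputs modulo $m$ lies in $A$; multiple wires are allowed. A $\mathrm{CC}_h[m]$-circuit is a depth-$h$ circuit built of gates $\mathrm{MOD}_m^A$. $\omega(m)$ is the number of distinct prime divisors of $m$. -}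

module Defs where

open import Data.Nat using (ℕ; zero; suc; _+_; _≤_; NonZero)
open import Data.Nat.DivMod using (_mod_)
open import Data.Nat.Divisibility using (_∣_; _∣?_)
open import Data.Nat.Primality using (Prime; prime?)
import Data.Bool
open import Data.Bool using (Bool; true; false; _∧_; if_then_else_)
open import Data.Fin using (Fin)
open import Data.Fin.Subset using (Subset)
open import Data.Vec using (Vec; []; _∷_; lookup; toList)
open import Data.List using (List; []; _∷_; length; filter; map; _++_; upTo)
open import Data.Bool.ListAction using (and)
open import Data.Product using (Σ; _×_)
open import Relation.Nullary.Decidable using (_×-dec_)
open import Relation.Binary.PropositionalEquality using (_≡_)

ω : ℕ → ℕ
ω m = length (filter (λ p → prime? p ×-dec (p ∣? m)) (upTo (suc m)))

-- Modular circuits with n inputs, gates MOD_m^A (A ⊆ {0,…,m-1}),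
-- unbounded fan-in (including fan-in 0), repeated wires allowed (a list of
-- children may repeat).  Circ m n d = circuits of depth at most d
-- (an input has depth 0, a gate has depth 1 + max depth of its inputs).
-- Sharing of subcircuits (DAG structure) does not change the computed
-- function or the depth, so circuits are represented as trees.
data Circ (m n : ℕ) : ℕ → Set where
  input : ∀ {d} → Fin n → Circ m n d
  gate  : ∀ {d} → Subset m → List (Circ m n d) → Circ m n (suc d)

b2n : Bool → ℕ
b2n true  = 1
b2n false = 0

mutual
  eval : ∀ {m n d} .{{_ : NonZero m}} → Circ m n d → Vec Bool n → Bool
  eval (input i) w = lookup w i
  eval {m} (gate A cs) w = lookup A (sumInputs cs w mod m)

  sumInputs : ∀ {m n d} .{{_ : NonZero m}} → List (Circ m n d) → Vec Bool n → ℕ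
  sumInputs []       w = 0
  sumInputs (c ∷ cs) w = b2n (eval c w) + sumInputs cs w

CC : (h m n : ℕ) → Set
CC h m n = Circ m n h

ANDComputable : (h m : ℕ) .{{_ : NonZero m}} → ℕ → Set
ANDComputable h m n = Σ (CC h m n) λ C → ∀ (w : Vec Bool n) → eval C w ≡ and (toList w)

Language : Set
Language = List Bool → Bool

Recognizable : (h m : ℕ) .{{_ : NonZero m}} → Language → Set
Recognizable h m L = ∀ (n : ℕ) → Σ (CC h m n) λ C →
  ∀ (w : Vec Bool n) → eval C w ≡ L (toList w)

words : (n : ℕ) → List (Vec Bool n)
words zero    = [] ∷ []
words (suc n) = map (true ∷_) (words n) ++ map (false ∷_) (words n)

countWords : Language → ℕ → ℕ
countWords L n = length (filter (λ w → L (toList w) Data.Bool.≟ true) (words n))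

-- A nonempty f such that AND_j(y) ∧ f(x) is computable (x of length n, y fresh) has at least
-- 2^(j+n-c) accepted words.  Branch on the first variable x₀ of f.  If both restrictions
-- x₀ = true and x₀ = false are nonempty, each is again of this form and the counts add up.
-- If only x₀ = b is nonempty, then f(x₀, T) = [x₀ = b] ∧ f(b, T), so the literal [x₀ = b]
-- joins the AND and j grows by one.  At n = 0 we are left with a circuit for AND_j, so j ≤ c.
-- Restricting variables to constants or literals keeps the circuit in CC_h[m]: a MOD_m^A gate
-- absorbs a constant or a negated input by rotating A, a negation x̄ being m − 1 copies of x
-- plus the constant 1.
module Submission where

open import Defs
open import Data.Nat
  using (ℕ; zero; suc; _+_; _*_; _∸_; _^_; _%_; _≤_; _≟_; _≤?_; z≤n; NonZero; >-nonZero⁻¹; ≢-nonZero)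
open import Data.Nat.Properties
open import Data.Nat.DivMod using (_mod_; %-distribˡ-+; m%n%n≡m%n; [m+kn]%n≡m%n)
open import Data.Nat.Solver using (module +-*-Solver)
open import Data.Bool as Bool using (Bool; true; false; not; _∧_)
open import Data.Bool.Properties using (not-involutive; ∧-zeroʳ; ∧-identityʳ)
open import Data.Bool.ListAction using (and)
open import Data.Fin as Fin using (Fin; toℕ)
open import Data.Fin.Properties using (toℕ-fromℕ<; fromℕ<-cong)
open import Data.Fin.Subset using (Subset)
open import Data.Vec using (Vec; []; _∷_; lookup; tabulate; toList)
open import Data.Vec.Properties using (lookup∘tabulate; tabulate-cong)
open import Data.List using (List; []; _∷_; _++_; replicate; filter; length; map)
open import Data.List.Properties using (length-++; filter-++)
open import Data.Product using (Σ; _,_)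
open import Data.Sum using (_⊎_; inj₁; inj₂)
open import Relation.Nullary using (yes; no; contradiction)
open import Relation.Binary.PropositionalEquality
  using (_≡_; refl; sym; trans; cong; cong₂; subst; subst₂; _≢_; module ≡-Reasoning)

data Literal (X : Set) : Set where
  constant : Bool → Literal X
  pos neg  : X → Literal X

⟦_⟧ : ∀ {X} → Literal X → (X → Bool) → Bool
⟦ constant b ⟧ ρ = b
⟦ pos x ⟧      ρ = ρ x
⟦ neg x ⟧      ρ = not (ρ x)

negate : ∀ {X} → Literal X → Literal X
negate (constant b) = constant (not b)
negate (pos x)      = neg x
negate (neg x)      = pos x

⟦negate⟧ : ∀ {X} (l : Literal X) ρ → ⟦ negate l ⟧ ρ ≡ not (⟦ l ⟧ ρ)
⟦negate⟧ (constant b) ρ = refl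
⟦negate⟧ (pos x)      ρ = refl
⟦negate⟧ (neg x)      ρ = sym (not-involutive (ρ x))

_>>=_ : ∀ {X Y} → Literal X → (X → Literal Y) → Literal Y
constant b >>= τ = constant b
pos x      >>= τ = τ x
neg x      >>= τ = negate (τ x)

⟦>>=⟧ : ∀ {X Y} (l : Literal X) (τ : X → Literal Y) ρ →
  ⟦ l >>= τ ⟧ ρ ≡ ⟦ l ⟧ (λ x → ⟦ τ x ⟧ ρ)
⟦>>=⟧ (constant b) τ ρ = refl
⟦>>=⟧ (pos x)      τ ρ = refl
⟦>>=⟧ (neg x)      τ ρ = ⟦negate⟧ (τ x) ρ

andᶠ : (n : ℕ) → (Fin n → Bool) → Bool
andᶠ zero    ρ = true
andᶠ (suc n) ρ = ρ Fin.zero ∧ andᶠ n (λ i → ρ (Fin.suc i))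

andᶠ-lookup : ∀ {n} (w : Vec Bool n) → andᶠ n (lookup w) ≡ and (toList w)
andᶠ-lookup []      = refl
andᶠ-lookup (x ∷ w) = cong (x ∧_) (andᶠ-lookup w)

andᶠ-true : ∀ n → andᶠ n (λ _ → true) ≡ true
andᶠ-true zero    = refl
andᶠ-true (suc n) = andᶠ-true n

literal-computes-andᶠ⇒≤1 : ∀ j (l : Literal (Fin j)) → (∀ ρ → ⟦ l ⟧ ρ ≡ andᶠ j ρ) → j ≤ 1
literal-computes-andᶠ⇒≤1 zero          l _ = z≤n
literal-computes-andᶠ⇒≤1 (suc zero)    l _ = ≤-refl
literal-computes-andᶠ⇒≤1 (suc (suc j)) (constant b) p
  with trans (sym (p (λ _ → false))) (trans (p (λ _ → true)) (andᶠ-true j))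
... | ()
literal-computes-andᶠ⇒≤1 (suc (suc j)) (neg x) p
  with trans (p (λ _ → true)) (andᶠ-true j)
... | ()
literal-computes-andᶠ⇒≤1 (suc (suc j)) (pos Fin.zero) p
  with p (λ { Fin.zero → true ; _ → false })
... | ()
literal-computes-andᶠ⇒≤1 (suc (suc j)) (pos (Fin.suc x)) p
  with p (λ { Fin.zero → false ; _ → true })
... | ()

count : ∀ n → (Vec Bool n → Bool) → ℕ
count n f = length (filter (λ w → f w Bool.≟ true) (words n))

length-filter-map : ∀ {k n} (f : Vec Bool n → Bool) (t : Vec Bool k → Vec Bool n) ws →
  length (filter (λ w → f w Bool.≟ true) (map t ws)) ≡
  length (filter (λ w → f (t w) Bool.≟ true) ws)
length-filter-map f t []       = refl
length-filter-map f t (w ∷ ws) with f (t w)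
... | true  = cong suc (length-filter-map f t ws)
... | false = length-filter-map f t ws

count-suc : ∀ n (f : Vec Bool (suc n) → Bool) →
  count (suc n) f ≡ count n (λ w → f (true ∷ w)) + count n (λ w → f (false ∷ w))
count-suc n f = begin
  length (filter P (map (true ∷_) (words n) ++ map (false ∷_) (words n)))
    ≡⟨ cong length (filter-++ P (map (true ∷_) (words n)) (map (false ∷_) (words n))) ⟩
  length (filter P (map (true ∷_) (words n)) ++ filter P (map (false ∷_) (words n)))
    ≡⟨ length-++ (filter P (map (true ∷_) (words n))) ⟩
  length (filter P (map (true ∷_) (words n))) + length (filter P (map (false ∷_) (words n)))
    ≡⟨ cong₂ _+_ (length-filter-map f (true ∷_) (words n))
                 (length-filter-map f (false ∷_) (words n)) ⟩
  count n (λ w → f (true ∷ w)) + count n (λ w → f (false ∷ w)) ∎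
  where
  open ≡-Reasoning
  P = λ (w : Vec Bool (suc n)) → f w Bool.≟ true

count-suc-one-sided : ∀ n (f : Vec Bool (suc n) → Bool) b →
  count n (λ w → f (not b ∷ w)) ≡ 0 → count (suc n) f ≡ count n (λ w → f (b ∷ w))
count-suc-one-sided n f true  empty =
  trans (count-suc n f) (trans (cong (count n (λ w → f (true ∷ w)) +_) empty) (+-identityʳ _))
count-suc-one-sided n f false empty =
  trans (count-suc n f) (cong (_+ count n (λ w → f (false ∷ w))) empty)

count≡0⇒false : ∀ n (f : Vec Bool n → Bool) → count n f ≡ 0 → ∀ w → f w ≡ false
count≡0⇒false zero f empty [] with f []
... | false = refl
count≡0⇒false zero f () [] | true
count≡0⇒false (suc n) f empty (true ∷ w) =
  count≡0⇒false n _ (m+n≡0⇒m≡0 _ (trans (sym (count-suc n f)) empty)) w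
count≡0⇒false (suc n) f empty (false ∷ w) =
  count≡0⇒false n _ (m+n≡0⇒n≡0 (count n (λ w → f (true ∷ w)))
                                 (trans (sym (count-suc n f)) empty)) w

count-zero≢0⇒true : (f : Vec Bool 0 → Bool) → count 0 f ≢ 0 → f [] ≡ true
count-zero≢0⇒true f nonempty with f []
... | true  = refl
... | false = contradiction refl nonempty

2^n≤k*2^c⇒2^[n∸c]≤k : ∀ n c k → k ≢ 0 → 2 ^ n ≤ k * 2 ^ c → 2 ^ (n ∸ c) ≤ k
2^n≤k*2^c⇒2^[n∸c]≤k n c k k≢0 le with c ≤? n
... | yes c≤n = *-cancelʳ-≤ (2 ^ (n ∸ c)) k (2 ^ c) {{m^n≢0 2 c}} (begin
  2 ^ (n ∸ c) * 2 ^ c ≡⟨ ^-distribˡ-+-* 2 (n ∸ c) c ⟨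
  2 ^ (n ∸ c + c)     ≡⟨ cong (2 ^_) (m∸n+n≡m c≤n) ⟩
  2 ^ n               ≤⟨ le ⟩
  k * 2 ^ c           ∎)
  where open ≤-Reasoning
... | no c≰n rewrite m≤n⇒m∸n≡0 (<⇒≤ (≰⇒> c≰n)) = n≢0⇒n>0 k≢0

module _ {m : ℕ} .{{_ : NonZero m}} where

  LiteralComputable : ℕ → (X : Set) → ((X → Bool) → Bool) → Set
  LiteralComputable h X F = Σ ℕ λ k → Σ (Circ m k h) λ C → Σ (Fin k → Literal X) λ σ →
    ∀ ρ → eval C (tabulate (λ i → ⟦ σ i ⟧ ρ)) ≡ F ρ

  substitute : ∀ {h X Y F} → LiteralComputable h X F → (τ : X → Literal Y) →
    LiteralComputable h Y (λ ρ → F (λ x → ⟦ τ x ⟧ ρ))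
  substitute (k , C , σ , correct) τ = k , C , (λ i → σ i >>= τ) , λ ρ →
    trans (cong (eval C) (tabulate-cong (λ i → ⟦>>=⟧ (σ i) τ ρ))) (correct _)

  computes-cong : ∀ {h X F G} → LiteralComputable h X F → (∀ ρ → F ρ ≡ G ρ) →
    LiteralComputable h X G
  computes-cong (k , C , σ , correct) F≗G = k , C , σ , λ ρ → trans (correct ρ) (F≗G ρ)

  -- One-sided congruence modulo m, avoiding truncated subtraction.
  infix 4 _≡ₘ_
  _≡ₘ_ : ℕ → ℕ → Set
  a ≡ₘ b = Σ ℕ λ k → a ≡ b + k * m

  ≡⇒≡ₘ : ∀ {a b} → a ≡ b → a ≡ₘ b
  ≡⇒≡ₘ {b = b} refl = 0 , sym (+-identityʳ b)

  +-cong-≡ₘ : ∀ {a b x y} → a ≡ₘ x → b ≡ₘ y → a + b ≡ₘ x + y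
  +-cong-≡ₘ {x = x} {y} (k , refl) (l , refl) = k + l ,
    solve 5 (λ x y k l m → (x :+ k :* m) :+ (y :+ l :* m) := (x :+ y) :+ (k :+ l) :* m)
            refl x y k l m
    where open +-*-Solver using (solve; _:+_; _:*_; _:=_)

  ≡ₘ⇒mod≡ : ∀ {a b} → a ≡ₘ b → a mod m ≡ b mod m
  ≡ₘ⇒mod≡ {b = b} (k , refl) = fromℕ<-cong _ _ ([m+kn]%n≡m%n b k m) _ _

  rotate : Subset m → ℕ → Subset m
  rotate A s = tabulate (λ r → lookup A ((toℕ r + s) mod m))

  lookup-rotate : ∀ A s x → lookup (rotate A s) (x mod m) ≡ lookup A ((x + s) mod m)
  lookup-rotate A s x =
    trans (lookup∘tabulate _ (x mod m)) (cong (lookup A) (fromℕ<-cong _ _ (begin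
    (toℕ (x mod m) + s) % m     ≡⟨ cong (λ r → (r + s) % m) (toℕ-fromℕ< _) ⟩
    (x % m + s) % m             ≡⟨ %-distribˡ-+ (x % m) s m ⟩
    (x % m % m + s % m) % m     ≡⟨ cong (λ r → (r + s % m) % m) (m%n%n≡m%n x m) ⟩
    (x % m + s % m) % m         ≡⟨ %-distribˡ-+ x s m ⟨
    (x + s) % m                 ∎) _ _))
    where open ≡-Reasoning

  sumInputs-++ : ∀ {n d} (cs ds : List (Circ m n d)) w →
    sumInputs (cs ++ ds) w ≡ sumInputs cs w + sumInputs ds w
  sumInputs-++ []       ds w = refl
  sumInputs-++ (c ∷ cs) ds w =
    trans (cong (b2n (eval c w) +_) (sumInputs-++ cs ds w)) (sym (+-assoc (b2n (eval c w)) _ _))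

  sumInputs-replicate : ∀ {n d} k (c : Circ m n d) w →
    sumInputs (replicate k c) w ≡ k * b2n (eval c w)
  sumInputs-replicate zero    c w = refl
  sumInputs-replicate (suc k) c w = cong (b2n (eval c w) +_) (sumInputs-replicate k c w)

  [m∸1]*b+1≡ₘnot-b : ∀ b → (m ∸ 1) * b2n b + 1 ≡ₘ b2n (not b)
  [m∸1]*b+1≡ₘnot-b true  = 1 , (begin
    (m ∸ 1) * 1 + 1 ≡⟨ cong (_+ 1) (*-identityʳ (m ∸ 1)) ⟩
    m ∸ 1 + 1       ≡⟨ m∸n+n≡m (>-nonZero⁻¹ m) ⟩
    m               ≡⟨ +-identityʳ m ⟨
    0 + 1 * m       ∎)
    where open ≡-Reasoning
  [m∸1]*b+1≡ₘnot-b false = ≡⇒≡ₘ (cong (_+ 1) (*-zeroʳ (m ∸ 1)))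

  module Inline {k j : ℕ} (σ : Fin k → Literal (Fin j)) where

    assign : Vec Bool j → Vec Bool k
    assign w = tabulate (λ i → ⟦ σ i ⟧ (lookup w))

    literalInputs : ∀ {d} → Literal (Fin j) → List (Circ m j d)
    literalInputs (constant b) = []
    literalInputs (pos x)      = input x ∷ []
    literalInputs (neg x)      = replicate (m ∸ 1) (input x)

    literalOffset : Literal (Fin j) → ℕ
    literalOffset (constant b) = b2n b
    literalOffset (pos x)      = 0
    literalOffset (neg x)      = 1

    mutual
      inlineGate : ∀ {d} → Subset m → List (Circ m k d) → Circ m j (suc d)
      inlineGate A cs = gate (rotate A (offset cs)) (inlineInputs cs)

      inlineInputs : ∀ {d} → List (Circ m k d) → List (Circ m j d)
      inlineInputs []                 = []
      inlineInputs (input i   ∷ cs)   = literalInputs (σ i) ++ inlineInputs cs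
      inlineInputs (gate A ds ∷ cs)   = inlineGate A ds ∷ inlineInputs cs

      offset : ∀ {d} → List (Circ m k d) → ℕ
      offset []               = 0
      offset (input i   ∷ cs) = literalOffset (σ i) + offset cs
      offset (gate A ds ∷ cs) = offset cs

    sumInputs-literalInputs : ∀ {d} (l : Literal (Fin j)) w →
      sumInputs (literalInputs {d} l) w + literalOffset l ≡ₘ b2n (⟦ l ⟧ (lookup w))
    sumInputs-literalInputs (constant b) w = ≡⇒≡ₘ refl
    sumInputs-literalInputs (pos x)      w = ≡⇒≡ₘ (trans (+-identityʳ _) (+-identityʳ _))
    sumInputs-literalInputs {d} (neg x)  w =
      subst (_≡ₘ b2n (not (lookup w x)))
        (cong (_+ 1) (sym (sumInputs-replicate (m ∸ 1) (input {d = d} x) w)))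
        ([m∸1]*b+1≡ₘnot-b (lookup w x))

    mutual
      eval-inlineGate : ∀ {d} (A : Subset m) (cs : List (Circ m k d)) w →
        eval (inlineGate A cs) w ≡ eval (gate A cs) (assign w)
      eval-inlineGate A cs w =
        trans (lookup-rotate A (offset cs) (sumInputs (inlineInputs cs) w))
              (cong (lookup A) (≡ₘ⇒mod≡ (sumInputs-inlineInputs cs w)))

      sumInputs-inlineInputs : ∀ {d} (cs : List (Circ m k d)) w →
        sumInputs (inlineInputs cs) w + offset cs ≡ₘ sumInputs cs (assign w)
      sumInputs-inlineInputs []               w = ≡⇒≡ₘ refl
      sumInputs-inlineInputs {d} (input i ∷ cs) w =
        subst₂ _≡ₘ_ (regroup (literalInputs (σ i)) (inlineInputs cs))
          (cong (λ b → b2n b + sumInputs cs (assign w)) (sym (lookup∘tabulate _ i)))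
          (+-cong-≡ₘ (sumInputs-literalInputs {d} (σ i) w) (sumInputs-inlineInputs cs w))
        where
        regroup : ∀ (ls rs : List (Circ m j d)) →
          (sumInputs ls w + literalOffset (σ i)) + (sumInputs rs w + offset cs) ≡
          sumInputs (ls ++ rs) w + (literalOffset (σ i) + offset cs)
        regroup ls rs rewrite sumInputs-++ ls rs w =
          solve 4 (λ a b s t → (a :+ s) :+ (b :+ t) := (a :+ b) :+ (s :+ t)) refl
            (sumInputs ls w) (sumInputs rs w) (literalOffset (σ i)) (offset cs)
          where open +-*-Solver using (solve; _:+_; _:=_)
      sumInputs-inlineInputs (gate A ds ∷ cs) w =
        subst₂ _≡ₘ_ (sym (+-assoc _ (sumInputs (inlineInputs cs) w) (offset cs)))
          (cong (_+ sumInputs cs (assign w)) (cong b2n (eval-inlineGate A ds w)))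
          (+-cong-≡ₘ (≡⇒≡ₘ refl) (sumInputs-inlineInputs cs w))

  Guarded : ℕ → ∀ j n → (Vec Bool n → Bool) → Set
  Guarded h j n f = LiteralComputable h (Fin j ⊎ Fin n)
    (λ ρ → andᶠ j (λ i → ρ (inj₁ i)) ∧ f (tabulate (λ x → ρ (inj₂ x))))

  recognizer⇒guarded : ∀ {h n} (f : Vec Bool n → Bool) →
    Σ (CC h m n) (λ C → ∀ w → eval C w ≡ f w) → Guarded h 0 n f
  recognizer⇒guarded {n = n} f (C , correct) =
    n , C , (λ x → pos (inj₂ x)) , λ ρ → correct (tabulate (λ x → ρ (inj₂ x)))

  restrict : ∀ {j n} → Bool → Fin j ⊎ Fin (suc n) → Literal (Fin j ⊎ Fin n)
  restrict b (inj₁ i)           = pos (inj₁ i)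
  restrict b (inj₂ Fin.zero)    = constant b
  restrict b (inj₂ (Fin.suc x)) = pos (inj₂ x)

  guarded-restrict : ∀ {h j n f} b → Guarded h j (suc n) f → Guarded h j n (λ w → f (b ∷ w))
  guarded-restrict b G = substitute G (restrict b)

  signed : ∀ {X} → Bool → X → Literal X
  signed true  = pos
  signed false = neg

  absorb : ∀ {j n} → Bool → Fin j ⊎ Fin (suc n) → Literal (Fin (suc j) ⊎ Fin n)
  absorb b (inj₁ i)           = pos (inj₁ (Fin.suc i))
  absorb b (inj₂ Fin.zero)    = signed b (inj₁ Fin.zero)
  absorb b (inj₂ (Fin.suc x)) = pos (inj₂ x)

  guarded-absorb : ∀ {h j n f} b → (∀ w → f (not b ∷ w) ≡ false) →
    Guarded h j (suc n) f → Guarded h (suc j) n (λ w → f (b ∷ w))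
  guarded-absorb {j = j} {n} {f} b vanishes G =
    computes-cong (substitute G (absorb b)) (λ ρ → agree b ρ (andᶠ j _) _ vanishes)
    where
    agree : ∀ b (ρ : Fin (suc j) ⊎ Fin n → Bool) a T → (∀ w → f (not b ∷ w) ≡ false) →
      a ∧ f (⟦ signed b (inj₁ Fin.zero) ⟧ ρ ∷ T) ≡ (ρ (inj₁ Fin.zero) ∧ a) ∧ f (b ∷ T)
    agree true  ρ a T vanishes with ρ (inj₁ Fin.zero)
    ... | true  = refl
    ... | false = trans (cong (a ∧_) (vanishes T)) (∧-zeroʳ a)
    agree false ρ a T vanishes with ρ (inj₁ Fin.zero)
    ... | true  = refl
    ... | false = trans (cong (a ∧_) (vanishes T)) (∧-zeroʳ a)

  module AndBound (h c : ℕ) (and≤c : ∀ n → ANDComputable h m n → n ≤ c) where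

    1≤c : 1 ≤ c
    1≤c = and≤c 1 (input Fin.zero , λ { (x ∷ []) → sym (∧-identityʳ x) })

    andᶠ-computable⇒≤c : ∀ {j} → LiteralComputable h (Fin j) (andᶠ j) → j ≤ c
    andᶠ-computable⇒≤c {j} (k , input i , σ , correct) =
      ≤-trans (literal-computes-andᶠ⇒≤1 j (σ i)
                 (λ ρ → trans (sym (lookup∘tabulate _ i)) (correct ρ)))
              1≤c
    andᶠ-computable⇒≤c {j} (k , gate A cs , σ , correct) =
      and≤c j (inlineGate A cs ,
               λ w → trans (eval-inlineGate A cs w) (trans (correct (lookup w)) (andᶠ-lookup w)))
      where open Inline σ

    guarded⇒≤c : ∀ {j} (f : Vec Bool 0 → Bool) → f [] ≡ true → Guarded h j 0 f → j ≤ c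
    guarded⇒≤c {j} f accepts G = andᶠ-computable⇒≤c (computes-cong (substitute G only-guard)
      (λ ρ → trans (cong (andᶠ j ρ ∧_) accepts) (∧-identityʳ (andᶠ j ρ))))
      where
      only-guard : Fin j ⊎ Fin 0 → Literal (Fin j)
      only-guard (inj₁ i) = pos i

    mutual
      guarded-count : ∀ n j (f : Vec Bool n → Bool) → Guarded h j n f →
        count n f ≢ 0 → 2 ^ (j + n) ≤ count n f * 2 ^ c
      guarded-count zero j f G nonempty = begin
        2 ^ (j + 0)       ≡⟨ cong (2 ^_) (+-identityʳ j) ⟩
        2 ^ j             ≤⟨ ^-monoʳ-≤ 2 (guarded⇒≤c f (count-zero≢0⇒true f nonempty) G) ⟩
        2 ^ c             ≤⟨ m≤n*m (2 ^ c) (count 0 f) {{≢-nonZero nonempty}} ⟩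
        count 0 f * 2 ^ c ∎
        where open ≤-Reasoning
      guarded-count (suc n) j f G nonempty rewrite +-suc j n
        with count n (λ w → f (true ∷ w)) ≟ 0 | count n (λ w → f (false ∷ w)) ≟ 0
      ... | yes empty₁ | yes empty₀ =
        contradiction (trans (count-suc n f) (cong₂ _+_ empty₁ empty₀)) nonempty
      ... | yes empty₁ | no _ = guarded-count-one-sided n j f G nonempty false empty₁
      ... | no _ | yes empty₀ = guarded-count-one-sided n j f G nonempty true empty₀
      ... | no nonempty₁ | no nonempty₀ = begin
        2 ^ (j + n) + (2 ^ (j + n) + 0) ≤⟨ +-mono-≤ bound₁ (≤-trans (≤-reflexive (+-identityʳ _))
                                                                      bound₀) ⟩
        count₁ * 2 ^ c + count₀ * 2 ^ c ≡⟨ *-distribʳ-+ (2 ^ c) count₁ count₀ ⟨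
        (count₁ + count₀) * 2 ^ c       ≡⟨ cong (_* 2 ^ c) (count-suc n f) ⟨
        count (suc n) f * 2 ^ c         ∎
        where
        open ≤-Reasoning
        count₁ = count n (λ w → f (true ∷ w))
        count₀ = count n (λ w → f (false ∷ w))
        bound₁ = guarded-count n j _ (guarded-restrict {f = f} true G) nonempty₁
        bound₀ = guarded-count n j _ (guarded-restrict {f = f} false G) nonempty₀

      guarded-count-one-sided : ∀ n j (f : Vec Bool (suc n) → Bool) → Guarded h j (suc n) f →
        count (suc n) f ≢ 0 → ∀ b → count n (λ w → f (not b ∷ w)) ≡ 0 →
        2 ^ suc (j + n) ≤ count (suc n) f * 2 ^ c
      guarded-count-one-sided n j f G nonempty b empty =
        subst (λ k → 2 ^ suc (j + n) ≤ k * 2 ^ c) (sym same-count)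
          (guarded-count n (suc j) _ (guarded-absorb {f = f} b (count≡0⇒false n _ empty) G)
            (λ empty-b → nonempty (trans same-count empty-b)))
        where same-count = count-suc-one-sided n f b empty

-- The hypotheses 1 ≤ h and (h = 1 or ω(m) = 1) are what makes such a bound c exist in the
-- paper; once c is given, the counting argument does not use them.
corollary2p5 : (h m : ℕ) .{{_ : NonZero m}} → 1 ≤ h → (h ≡ 1 ⊎ ω m ≡ 1) →
    (c : ℕ) → (∀ n → ANDComputable h m n → n ≤ c) →
    (L : Language) → Recognizable h m L →
    (n : ℕ) → countWords L n ≡ 0 ⊎ 2 ^ (n ∸ c) ≤ countWords L n
corollary2p5 h m _ _ c and≤c L recognizable n with countWords L n ≟ 0
... | yes empty    = inj₁ empty
... | no  nonempty = inj₂ (2^n≤k*2^c⇒2^[n∸c]≤k n c (countWords L n) nonempty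
  (AndBound.guarded-count h c and≤c n 0 accepts
    (recognizer⇒guarded accepts (recognizable n)) nonempty))
  where
  accepts : Vec Bool n → Bool
  accepts w = L (toList w)
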